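{- Let $H(X,Y,E)$ be a complete bipartite $r$-uniform hypergraph with $n$ vertices in total ($n=|X|+|Y|$), where $n\ge 3$ and $3\le r\le n$. Then the domatic number of $H$ is $d(H)=n$ and the total domatic number of $H$ is $d_t(H)=\lfloor n/2\rfloor$.
   Context: A hypergraph has a finite vertex set and a set of hyperedges, each a subset of the vertex set; it is $r$-uniform if every hyperedge has exactly $r$ vertices. A complete bipartite $r$-uniform hypergraph $H(X,Y,E)$ has vertex set $X\cup Y$ with $X,Y$ disjoint and nonempty, and its hyperedges are all $r$-element subsets of $X\cup Y$ containing at least one vertex of $X$ and at least one vertex of $Y$. Two distinct vertices are adjacent if they lie in a common hyperedge; a vertex is not adjacent to itself. A dominating set is a subset $D$ of vertices such that every vertex outside $D$ is adjacent to some vertex of $D$. The domatic number $d(H)$ is the maximum number of classes in a partition of the vertex set into dominating sets. A total dominating set is a subset $T$ of vertices such that every vertex is adjacent to some vertex of $T$; the total domatic number $d_t(H)$ is the maximum number of classes in a partition of the vertex set into total dominating sets. -}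

module Defs where

open import Data.Nat using (ℕ; _≤_)
open import Data.Fin using (Fin)
open import Data.Fin.Subset using (Subset; _∈_; ∣_∣; ∁)
open import Data.Product using (Σ; ∃; ∃-syntax; _×_)
open import Relation.Nullary using (¬_)
open import Relation.Binary.PropositionalEquality using (_≡_; _≢_)
open import Relation.Unary using (Pred)
open import Level using (0ℓ)

record Hypergraph (n : ℕ) : Set₁ where
  field
    Edge : Subset n → Set

open Hypergraph public

-- Complete bipartite r-uniform hypergraph H(X,Y,E) on vertex set Fin n = X ∪ Y,
-- with Y the complement of X: hyperedges are all r-element subsets meeting both X and Y.
completeBipartite : (n r : ℕ) → Subset n → Hypergraph n
completeBipartite n r X = record
  { Edge = λ e → (∣ e ∣ ≡ r)
                 × (∃[ x ] (x ∈ e × x ∈ X))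
                 × (∃[ y ] (y ∈ e × y ∈ ∁ X)) }

Adjacent : {n : ℕ} → Hypergraph n → Fin n → Fin n → Set
Adjacent H u v = (u ≢ v) × (∃[ e ] (Edge H e × u ∈ e × v ∈ e))

Dominating : {n : ℕ} → Hypergraph n → Pred (Fin n) 0ℓ → Set
Dominating H D = ∀ v → ¬ D v → ∃[ u ] (D u × Adjacent H u v)

TotalDominating : {n : ℕ} → Hypergraph n → Pred (Fin n) 0ℓ → Set
TotalDominating H T = ∀ v → ∃[ u ] (T u × Adjacent H u v)

-- A partition of the vertex set into k (nonempty) classes, given by a surjective
-- class map f : Fin n → Fin k; class i is {v | f v ≡ i}.
PartitionInto : {n : ℕ} → (Hypergraph n → Pred (Fin n) 0ℓ → Set) → Hypergraph n → ℕ → Set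
PartitionInto {n} P H k =
  Σ (Fin n → Fin k) λ f →
    (∀ i → ∃[ v ] (f v ≡ i)) × (∀ i → P H (λ v → f v ≡ i))

IsMaxPartition : {n : ℕ} → (Hypergraph n → Pred (Fin n) 0ℓ → Set) → Hypergraph n → ℕ → Set
IsMaxPartition P H m = PartitionInto P H m × (∀ k → PartitionInto P H k → k ≤ m)

DomaticNumber : {n : ℕ} → Hypergraph n → ℕ → Set
DomaticNumber = IsMaxPartition Dominating

TotalDomaticNumber : {n : ℕ} → Hypergraph n → ℕ → Set
TotalDomaticNumber = IsMaxPartition TotalDominating

-- In H, any two distinct vertices u and v are adjacent: pick w on the side
-- of the bipartition opposite to u and enlarge {u, v, w} to an r-set, which
-- is a hyperedge since it meets both X and Y.  So every set containing a
-- vertex dominates and every set with two vertices totally dominates: the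
-- singletons give n dominating classes, and the residues modulo ⌊n/2⌋ give
-- ⌊n/2⌋ classes of size at least two.  Conversely classes of a partition are
-- nonempty, and each class of a total domatic partition must hold a neighbour
-- of its own members, so has at least two vertices.
module Submission where

open import Defs
open import Data.Nat using (ℕ; suc; _+_; _*_; _≤_; _<_; z≤n; s≤s; _≤?_; _/_; NonZero; >-nonZero; >-nonZero⁻¹)
open import Data.Nat.Properties
  using (≤-trans; ≤-reflexive; ≤-antisym; ≰⇒>; n≤1+n; +-suc; +-monoʳ-≤; *-suc; *-identityʳ;
         <⇒≢; <-trans; m<m+n; +-monoˡ-<; module ≤-Reasoning)
open import Data.Nat.DivMod using (_%_; _mod_; m%n<n; m<n⇒m%n≡m; [m+n]%n≡m%n; m*n/n≡m; /-monoˡ-≤; m/n*n≤m; m≥n⇒m/n>0)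
open import Data.Fin using (Fin; toℕ; fromℕ<; splitAt; join)
open import Data.Fin.Properties using (_≟_; toℕ-injective; toℕ-fromℕ<; toℕ<n; injective⇒≤; join-splitAt; fromℕ<-injective)
open import Data.Fin.Subset using (Subset; _∈_; _⊆_; ∣_∣; ⁅_⁆; _∪_; ∁; ⊤; Nonempty; inside; outside)
open import Data.Fin.Subset.Properties using (_∈?_; x∈⁅x⁆; ∣⁅x⁆∣≡1; x∈p∪q⁺; x∉p⇒x∈∁p; ⊆⊤; ∣⊤∣≡n)
open import Data.Vec using (_∷_; []; here; there)
open import Data.Product using (_×_; _,_; proj₁; proj₂; ∃-syntax)
open import Data.Sum using (_⊎_; inj₁; inj₂; [_,_])
open import Function using (id; _∘_)
open import Level using (0ℓ)
open import Relation.Nullary using (yes; no; contradiction)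
open import Relation.Unary using (Pred)
open import Relation.Binary.PropositionalEquality using (_≡_; _≢_; refl; sym; trans; cong; cong₂; module ≡-Reasoning)

m+m≡m*2 : ∀ m → m + m ≡ m * 2
m+m≡m*2 m = sym (trans (*-suc m 1) (cong (m +_) (*-identityʳ m)))

m+m≤n⇒m≤n/2 : ∀ {m n} → m + m ≤ n → m ≤ n / 2
m+m≤n⇒m≤n/2 {m} {n} m+m≤n = begin
  m         ≡⟨ m*n/n≡m m 2 ⟨
  m * 2 / 2 ≤⟨ /-monoˡ-≤ 2 (≤-trans (≤-reflexive (sym (m+m≡m*2 m))) m+m≤n) ⟩
  n / 2     ∎
  where open ≤-Reasoning

n/2+n/2≤n : ∀ n → n / 2 + n / 2 ≤ n
n/2+n/2≤n n = ≤-trans (≤-reflexive (m+m≡m*2 (n / 2))) (m/n*n≤m n 2)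

⊎-injection⇒+≤ : ∀ {a b n} (g : Fin a ⊎ Fin b → Fin n) → (∀ {x y} → g x ≡ g y → x ≡ y) → a + b ≤ n
⊎-injection⇒+≤ {a} {b} g g-injective = injective⇒≤ {f = λ x → g (splitAt a x)} injective
  where
  injective : ∀ {x y} → g (splitAt a x) ≡ g (splitAt a y) → x ≡ y
  injective {x} {y} eq = begin
    x                    ≡⟨ join-splitAt a b x ⟨
    join a b (splitAt a x) ≡⟨ cong (join a b) (g-injective eq) ⟩
    join a b (splitAt a y) ≡⟨ join-splitAt a b y ⟩
    y                    ∎
    where open ≡-Reasoning

∣p∪q∣≤∣p∣+∣q∣ : ∀ {n} (p q : Subset n) → ∣ p ∪ q ∣ ≤ ∣ p ∣ + ∣ q ∣
∣p∪q∣≤∣p∣+∣q∣ []            []            = z≤n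
∣p∪q∣≤∣p∣+∣q∣ (inside ∷ p)  (inside ∷ q)  = s≤s (≤-trans (∣p∪q∣≤∣p∣+∣q∣ p q) (+-monoʳ-≤ ∣ p ∣ (n≤1+n ∣ q ∣)))
∣p∪q∣≤∣p∣+∣q∣ (inside ∷ p)  (outside ∷ q) = s≤s (∣p∪q∣≤∣p∣+∣q∣ p q)
∣p∪q∣≤∣p∣+∣q∣ (outside ∷ p) (inside ∷ q)  = ≤-trans (s≤s (∣p∪q∣≤∣p∣+∣q∣ p q)) (≤-reflexive (sym (+-suc ∣ p ∣ ∣ q ∣)))
∣p∪q∣≤∣p∣+∣q∣ (outside ∷ p) (outside ∷ q) = ∣p∪q∣≤∣p∣+∣q∣ p q

⊆-superset-of-size : ∀ {n r} (S : Subset n) → ∣ S ∣ ≤ r → r ≤ n → ∃[ e ] (S ⊆ e × ∣ e ∣ ≡ r)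
⊆-superset-of-size []            z≤n       z≤n       = [] , id , refl
⊆-superset-of-size (inside ∷ S)  (s≤s ∣S∣≤r) (s≤s r≤n)
  with e , S⊆e , ∣e∣≡r ← ⊆-superset-of-size S ∣S∣≤r r≤n
  = inside ∷ e , (λ { here → here ; (there x∈S) → there (S⊆e x∈S) }) , cong suc ∣e∣≡r
⊆-superset-of-size {suc n} {r} (outside ∷ S) ∣S∣≤r r≤1+n with r ≤? n
... | yes r≤n with e , S⊆e , ∣e∣≡r ← ⊆-superset-of-size S ∣S∣≤r r≤n
  = outside ∷ e , (λ { (there x∈S) → there (S⊆e x∈S) }) , ∣e∣≡r
... | no r≰n = ⊤ , ⊆⊤ , trans (∣⊤∣≡n (suc n)) (≤-antisym (≰⇒> r≰n) r≤1+n)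

partition⇒classes≤vertices : ∀ {n k} {P : Hypergraph n → Pred (Fin n) 0ℓ → Set} {H : Hypergraph n} →
                             PartitionInto P H k → k ≤ n
partition⇒classes≤vertices {n} {k} (class , surjective , _) = injective⇒≤ {f = rep} rep-injective
  where
  rep : Fin k → Fin n
  rep i = proj₁ (surjective i)

  rep-injective : ∀ {i j} → rep i ≡ rep j → i ≡ j
  rep-injective {i} {j} eq = trans (sym (proj₂ (surjective i))) (trans (cong class eq) (proj₂ (surjective j)))

totalPartition⇒classes+classes≤vertices : ∀ {n k} {H : Hypergraph n} → PartitionInto TotalDominating H k → k + k ≤ n
totalPartition⇒classes+classes≤vertices {n} {k} (class , surjective , total) = ⊎-injection⇒+≤ pick pick-injective
  where
  rep mate : Fin k → Fin n
  rep i  = proj₁ (surjective i)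
  mate i = proj₁ (total i (rep i))

  mate≢rep : ∀ i → mate i ≢ rep i
  mate≢rep i = proj₁ (proj₂ (proj₂ (total i (rep i))))

  pick : Fin k ⊎ Fin k → Fin n
  pick = [ rep , mate ]

  class-pick : ∀ x → class (pick x) ≡ [ id , id ] x
  class-pick (inj₁ i) = proj₂ (surjective i)
  class-pick (inj₂ i) = proj₁ (proj₂ (total i (rep i)))

  same-class : ∀ x y → pick x ≡ pick y → [ id , id ] x ≡ [ id , id ] y
  same-class x y eq = trans (sym (class-pick x)) (trans (cong class eq) (class-pick y))

  pick-injective : ∀ {x y} → pick x ≡ pick y → x ≡ y
  pick-injective {inj₁ i} {inj₁ j} eq = cong inj₁ (same-class (inj₁ i) (inj₁ j) eq)
  pick-injective {inj₂ i} {inj₂ j} eq = cong inj₂ (same-class (inj₂ i) (inj₂ j) eq)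
  pick-injective {inj₁ i} {inj₂ j} eq with refl ← same-class (inj₁ i) (inj₂ j) eq = contradiction (sym eq) (mate≢rep i)
  pick-injective {inj₂ i} {inj₁ j} eq with refl ← same-class (inj₂ i) (inj₁ j) eq = contradiction eq (mate≢rep i)

PairwiseAdjacent : ∀ {n} → Hypergraph n → Set
PairwiseAdjacent H = ∀ u v → u ≢ v → Adjacent H u v

module _ {n} {H : Hypergraph n} (adjacent : PairwiseAdjacent H) where

  pairwiseAdjacent⇒dominating : ∀ {D u} → D u → Dominating H D
  pairwiseAdjacent⇒dominating {u = u} Du v ¬Dv = u , Du , adjacent u v (λ { refl → ¬Dv Du })

  pairwiseAdjacent⇒totalDominating : ∀ {T a b} → T a → T b → a ≢ b → TotalDominating H T
  pairwiseAdjacent⇒totalDominating {a = a} {b} Ta Tb a≢b v with v ≟ a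
  ... | yes refl = b , Tb , adjacent b v (λ b≡a → a≢b (sym b≡a))
  ... | no v≢a   = a , Ta , adjacent a v (λ a≡v → v≢a (sym a≡v))

  pairwiseAdjacent⇒singletonPartition : PartitionInto Dominating H n
  pairwiseAdjacent⇒singletonPartition = id , (λ i → i , refl) , λ i → pairwiseAdjacent⇒dominating refl

  pairwiseAdjacent⇒residuePartition : ∀ k .{{_ : NonZero k}} → k + k ≤ n → PartitionInto TotalDominating H k
  pairwiseAdjacent⇒residuePartition k k+k≤n =
    class , (λ i → low i , class-low i) ,
    λ i → pairwiseAdjacent⇒totalDominating (class-low i) (class-high i) (low≢high i)
    where
    open ≡-Reasoning

    class : Fin n → Fin k
    class v = toℕ v mod k

    class-fromℕ< : ∀ {m} (m<n : m < n) (i : Fin k) → m % k ≡ toℕ i → class (fromℕ< m<n) ≡ i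
    class-fromℕ< {m} m<n i m%k≡i = toℕ-injective (begin
      toℕ (class (fromℕ< m<n)) ≡⟨ toℕ-fromℕ< (m%n<n (toℕ (fromℕ< m<n)) k) ⟩
      toℕ (fromℕ< m<n) % k     ≡⟨ cong (_% k) (toℕ-fromℕ< m<n) ⟩
      m % k                    ≡⟨ m%k≡i ⟩
      toℕ i                    ∎)

    i<i+k : (i : Fin k) → toℕ i < toℕ i + k
    i<i+k i = m<m+n (toℕ i) (>-nonZero⁻¹ k)

    i+k<n : (i : Fin k) → toℕ i + k < n
    i+k<n i = ≤-trans (+-monoˡ-< k (toℕ<n i)) k+k≤n

    i<n : (i : Fin k) → toℕ i < n
    i<n i = <-trans (i<i+k i) (i+k<n i)

    low high : Fin k → Fin n
    low i  = fromℕ< (i<n i)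
    high i = fromℕ< (i+k<n i)

    class-low : ∀ i → class (low i) ≡ i
    class-low i = class-fromℕ< (i<n i) i (m<n⇒m%n≡m (toℕ<n i))

    class-high : ∀ i → class (high i) ≡ i
    class-high i = class-fromℕ< (i+k<n i) i (trans ([m+n]%n≡m%n (toℕ i) k) (m<n⇒m%n≡m (toℕ<n i)))

    low≢high : ∀ i → low i ≢ high i
    low≢high i eq = <⇒≢ (i<i+k i) (fromℕ<-injective _ _ _ _ eq)

  pairwiseAdjacent⇒domaticNumber : DomaticNumber H n
  pairwiseAdjacent⇒domaticNumber = pairwiseAdjacent⇒singletonPartition , λ _ → partition⇒classes≤vertices {P = Dominating}

  pairwiseAdjacent⇒totalDomaticNumber : 2 ≤ n → TotalDomaticNumber H (n / 2)
  pairwiseAdjacent⇒totalDomaticNumber 2≤n =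
    pairwiseAdjacent⇒residuePartition (n / 2) {{>-nonZero (m≥n⇒m/n>0 2≤n)}} (n/2+n/2≤n n) ,
    λ _ → m+m≤n⇒m≤n/2 ∘ totalPartition⇒classes+classes≤vertices

OppositeSides : ∀ {n} → Subset n → Fin n → Fin n → Set
OppositeSides X u w = (u ∈ X × w ∈ ∁ X) ⊎ (w ∈ X × u ∈ ∁ X)

opposite-vertex : ∀ {n} {X : Subset n} → Nonempty X → Nonempty (∁ X) → ∀ u → ∃[ w ] OppositeSides X u w
opposite-vertex {X = X} (x , x∈X) (y , y∈Y) u with u ∈? X
... | yes u∈X = y , inj₁ (u∈X , y∈Y)
... | no  u∉X = x , inj₂ (x∈X , x∉p⇒x∈∁p u∉X)

completeBipartite-edge : ∀ {n r} {X : Subset n} {e u w} →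
                         ∣ e ∣ ≡ r → u ∈ e → w ∈ e → OppositeSides X u w → Edge (completeBipartite n r X) e
completeBipartite-edge ∣e∣≡r u∈e w∈e (inj₁ (u∈X , w∈Y)) = ∣e∣≡r , (_ , u∈e , u∈X) , (_ , w∈e , w∈Y)
completeBipartite-edge ∣e∣≡r u∈e w∈e (inj₂ (w∈X , u∈Y)) = ∣e∣≡r , (_ , w∈e , w∈X) , (_ , u∈e , u∈Y)

∣⁅u⁆∪⁅v⁆∪⁅w⁆∣≤3 : ∀ {n} (u v w : Fin n) → ∣ ⁅ u ⁆ ∪ (⁅ v ⁆ ∪ ⁅ w ⁆) ∣ ≤ 3
∣⁅u⁆∪⁅v⁆∪⁅w⁆∣≤3 u v w = begin
  ∣ ⁅ u ⁆ ∪ (⁅ v ⁆ ∪ ⁅ w ⁆) ∣           ≤⟨ ∣p∪q∣≤∣p∣+∣q∣ ⁅ u ⁆ (⁅ v ⁆ ∪ ⁅ w ⁆) ⟩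
  ∣ ⁅ u ⁆ ∣ + ∣ ⁅ v ⁆ ∪ ⁅ w ⁆ ∣         ≤⟨ +-monoʳ-≤ ∣ ⁅ u ⁆ ∣ (∣p∪q∣≤∣p∣+∣q∣ ⁅ v ⁆ ⁅ w ⁆) ⟩
  ∣ ⁅ u ⁆ ∣ + (∣ ⁅ v ⁆ ∣ + ∣ ⁅ w ⁆ ∣)   ≡⟨ cong₂ _+_ (∣⁅x⁆∣≡1 u) (cong₂ _+_ (∣⁅x⁆∣≡1 v) (∣⁅x⁆∣≡1 w)) ⟩
  3                                     ∎
  where open ≤-Reasoning

completeBipartite-pairwiseAdjacent : ∀ {n r} {X : Subset n} → Nonempty X → Nonempty (∁ X) →
                                     3 ≤ r → r ≤ n → PairwiseAdjacent (completeBipartite n r X)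
completeBipartite-pairwiseAdjacent X≢∅ Y≢∅ 3≤r r≤n u v u≢v
  with w , u|w ← opposite-vertex X≢∅ Y≢∅ u
  with e , uvw⊆e , ∣e∣≡r ← ⊆-superset-of-size (⁅ u ⁆ ∪ (⁅ v ⁆ ∪ ⁅ w ⁆)) (≤-trans (∣⁅u⁆∪⁅v⁆∪⁅w⁆∣≤3 u v w) 3≤r) r≤n
  = u≢v , e , completeBipartite-edge ∣e∣≡r u∈e w∈e u|w , u∈e , v∈e
  where
  u∈e : u ∈ e
  u∈e = uvw⊆e (x∈p∪q⁺ (inj₁ (x∈⁅x⁆ u)))
  v∈e : v ∈ e
  v∈e = uvw⊆e (x∈p∪q⁺ (inj₂ (x∈p∪q⁺ (inj₁ (x∈⁅x⁆ v)))))
  w∈e : w ∈ e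
  w∈e = uvw⊆e (x∈p∪q⁺ (inj₂ (x∈p∪q⁺ (inj₂ (x∈⁅x⁆ w)))))

theorem2 : (n r : ℕ) (X : Subset n)
    → Nonempty X → Nonempty (∁ X)
    → 3 ≤ n → 3 ≤ r → r ≤ n
    → DomaticNumber (completeBipartite n r X) n
    × TotalDomaticNumber (completeBipartite n r X) (n / 2)
theorem2 n r X X≢∅ Y≢∅ 3≤n 3≤r r≤n =
  pairwiseAdjacent⇒domaticNumber adjacent ,
  pairwiseAdjacent⇒totalDomaticNumber adjacent (≤-trans (n≤1+n 2) 3≤n)
  where
  adjacent : PairwiseAdjacent (completeBipartite n r X)
  adjacent = completeBipartite-pairwiseAdjacent X≢∅ Y≢∅ 3≤r r≤n
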